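{- Fix an integer $\ell\geq1$. Then $$\lim_{c\to\infty}\frac{\#\{\varphi_{(p-1)^\ell,c}(x)\in\mathbb{Z}[x]:\ 5\leq p\leq c\ \text{prime and}\ Y_c^{(2)}(p)=2\}}{\#\{\varphi_{(p-1)^\ell,c}(x)\in\mathbb{Z}[x]:\ 5\leq p\leq c\ \text{prime}\}}=0.$$
   Context: For a prime $p$, an integer $\ell\geq1$ and $c\in\mathbb{Z}\subset\mathbb{Z}_p$, let $\varphi_{(p-1)^\ell,c}(x)=x^{(p-1)^\ell}+c$ and $Y_c^{(2)}(p)=\#\{z\in\mathbb{Z}_p/p\mathbb{Z}_p:\ \varphi_{(p-1)^\ell,c}(z)-z\not\equiv0\pmod{p\mathbb{Z}_p},\ \varphi_{(p-1)^\ell,c}^2(z)-z\equiv0\pmod{p\mathbb{Z}_p}\}$, where $\varphi^2=\varphi\circ\varphi$. For fixed $c$ the polynomials counted are indexed by the primes $p$ with $5\leq p\leq c$. -}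

module Defs where

open import Data.Nat as ℕ using (ℕ; suc; _∸_; _^_; _≤_; _≤?_)
open import Data.Nat.Divisibility as ℕD using (_∣?_)
open import Data.Nat.Primality using (Prime; prime?)
open import Data.Integer as ℤ using (ℤ; +_; _-_; ∣_∣)
open import Data.Integer.Divisibility using (_∣_)
open import Data.List using (List; length; filter; upTo)
open import Data.Product using (_×_)
open import Relation.Nullary using (Dec; ¬_; ¬?)
open import Relation.Nullary.Decidable using (_×-dec_)

φ : (p ℓ : ℕ) → (c : ℤ) → ℤ → ℤ
φ p ℓ c x = x ℤ.^ ((p ∸ 1) ^ ℓ) ℤ.+ c

_≡_[mod_] : ℤ → ℤ → ℕ → Set
a ≡ b [mod p ] = (+ p) ∣ (a - b)

_≡?_[mod_] : (a b : ℤ) (p : ℕ) → Dec (a ≡ b [mod p ])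
a ≡? b [mod p ] = p ∣? ∣ a - b ∣

Period2 : (p ℓ : ℕ) (c : ℤ) (z : ℕ) → Set
Period2 p ℓ c z =
  (¬ (φ p ℓ c (+ z) ≡ + z [mod p ])) × (φ p ℓ c (φ p ℓ c (+ z)) ≡ + z [mod p ])

period2? : (p ℓ : ℕ) (c : ℤ) (z : ℕ) → Dec (Period2 p ℓ c z)
period2? p ℓ c z =
  ¬? (φ p ℓ c (+ z) ≡? + z [mod p ]) ×-dec (φ p ℓ c (φ p ℓ c (+ z)) ≡? + z [mod p ])

-- Y_c^{(2)}(p): residues z ∈ {0,…,p-1} ≅ ℤ_p/pℤ_p with exact period 2
Y2 : (ℓ : ℕ) (c : ℤ) (p : ℕ) → ℕ
Y2 ℓ c p = length (filter (period2? p ℓ c) (upTo p))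

PrimeIn : (c p : ℕ) → Set
PrimeIn c p = Prime p × (5 ≤ p × p ≤ c)

primeIn? : (c p : ℕ) → Dec (PrimeIn c p)
primeIn? c p = prime? p ×-dec ((5 ≤? p) ×-dec (p ≤? c))

denom : (c : ℕ) → ℕ
denom c = length (filter (primeIn? c) (upTo (suc c)))

PrimeInY2 : (ℓ c p : ℕ) → Set
PrimeInY2 ℓ c p = PrimeIn c p × (Y2 ℓ (+ c) p ≡ℕ 2)
  where open import Relation.Binary.PropositionalEquality renaming (_≡_ to _≡ℕ_)

primeInY2? : (ℓ c p : ℕ) → Dec (PrimeInY2 ℓ c p)
primeInY2? ℓ c p = primeIn? c p ×-dec (Y2 ℓ (+ c) p ℕ.≟ 2)

numer : (ℓ c : ℕ) → ℕ
numer ℓ c = length (filter (primeInY2? ℓ c) (upTo (suc c)))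

-- By Fermat's little theorem y^((p-1)^ℓ) is 0 or 1 modulo p, so φ takes only the values
-- c and c + 1 modulo p. If p ∤ c + 1, then c + 1 is a fixed point and c is the only value
-- of φ that is not fixed; a 2-cycle consists of two distinct such values, so none exists.
-- Hence the numerator only counts primes dividing c + 1, of which there are at most
-- m + log_m (c + 1) for every m. Erdős' argument (n = a² s with s squarefree) gives
-- c < 4^(π(c) + 1), so the denominator is at least of order log c; m = 4^(K+1) then makes
-- the ratio smaller than 1/K for all large c.
module Submission where

open import Defs

module CongruenceModP where

  open import Data.Nat as ℕ using (ℕ; zero; suc)
  import Data.Nat.Divisibility as ℕ
  open import Data.Nat.Primality using (Prime; euclidsLemma)
  open import Data.Integer as ℤ using (ℤ; +_; 0ℤ; _+_; _-_; _*_; _^_; ∣_∣)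
  import Data.Integer.Properties as ℤ
  open import Data.Integer.Divisibility.Signed as Signed
    using (∣ᵤ⇒∣; ∣⇒∣ᵤ; ∣m∣n⇒∣m+n; ∣n⇒∣m*n; ∣m⇒∣m*n)
  open import Data.Integer.Tactic.RingSolver using (solve-∀)
  open import Data.Sum as Sum using (_⊎_)
  open import Function using (_∘_)
  open import Relation.Nullary using (Dec)
  open import Relation.Nullary.Decidable using (map′)
  open import Relation.Binary.Bundles using (Setoid)
  open import Relation.Binary.PropositionalEquality using (_≡_; refl; sym; subst)

  -- The congruence of Defs unfolds to ℕ-divisibility of ∣ a - b ∣, from which Agda cannot
  -- infer a and b; wrapping it in a record makes them inferable.
  infix 4 _≈_[mod_]
  record _≈_[mod_] (a b : ℤ) (p : ℕ) : Set where
    constructor mod-cong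
    field ≡-mod : a ≡ b [mod p ]
  open _≈_[mod_] public

  module _ {p : ℕ} where

    private
      fromSigned : ∀ {a b} → + p Signed.∣ (a - b) → a ≈ b [mod p ]
      fromSigned = mod-cong ∘ ∣⇒∣ᵤ

      toSigned : ∀ {a b} → a ≈ b [mod p ] → + p Signed.∣ (a - b)
      toSigned = ∣ᵤ⇒∣ ∘ ≡-mod

    ≈-mod-refl : ∀ {a} → a ≈ a [mod p ]
    ≈-mod-refl {a} = mod-cong (subst (λ x → p ℕ.∣ ∣ x ∣) (sym (ℤ.+-inverseʳ a)) (p ℕ.∣0))

    ≈-mod-reflexive : ∀ {a b} → a ≡ b → a ≈ b [mod p ]
    ≈-mod-reflexive refl = ≈-mod-refl

    ≈-mod-sym : ∀ {a b} → a ≈ b [mod p ] → b ≈ a [mod p ]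
    ≈-mod-sym {a} {b} (mod-cong d) = mod-cong (subst (p ℕ.∣_) (ℤ.∣i-j∣≡∣j-i∣ a b) d)

    ≈-mod-trans : ∀ {a b c} → a ≈ b [mod p ] → b ≈ c [mod p ] → a ≈ c [mod p ]
    ≈-mod-trans {a} {b} {c} a≈b b≈c = fromSigned (subst (+ p Signed.∣_) (telescope a b c)
      (∣m∣n⇒∣m+n (toSigned a≈b) (toSigned b≈c)))
      where
      telescope : ∀ a b c → (a - b) + (b - c) ≡ a - c
      telescope = solve-∀

    +-cong-mod : ∀ {a b c d} → a ≈ b [mod p ] → c ≈ d [mod p ] → a + c ≈ b + d [mod p ]
    +-cong-mod {a} {b} {c} {d} a≈b c≈d = fromSigned (subst (+ p Signed.∣_) (regroup a b c d)
      (∣m∣n⇒∣m+n (toSigned a≈b) (toSigned c≈d)))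
      where
      regroup : ∀ a b c d → (a - b) + (c - d) ≡ (a + c) - (b + d)
      regroup = solve-∀

    *-cong-mod : ∀ {a b c d} → a ≈ b [mod p ] → c ≈ d [mod p ] → a * c ≈ b * d [mod p ]
    *-cong-mod {a} {b} {c} {d} a≈b c≈d = fromSigned (subst (+ p Signed.∣_) (regroup a b c d)
      (∣m∣n⇒∣m+n (∣m⇒∣m*n c (toSigned a≈b)) (∣n⇒∣m*n b (toSigned c≈d))))
      where
      regroup : ∀ a b c d → (a - b) * c + b * (c - d) ≡ a * c - b * d
      regroup = solve-∀

    ^-cong-mod : ∀ {a b} n → a ≈ b [mod p ] → a ^ n ≈ b ^ n [mod p ]
    ^-cong-mod zero    a≈b = ≈-mod-refl
    ^-cong-mod (suc n) a≈b = *-cong-mod a≈b (^-cong-mod n a≈b)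

    +-cancelˡ-mod : ∀ c {a b} → c + a ≈ c + b [mod p ] → a ≈ b [mod p ]
    +-cancelˡ-mod c {a} {b} (mod-cong d) = mod-cong (subst (λ x → p ℕ.∣ ∣ x ∣) (cancel c a b) d)
      where
      cancel : ∀ c a b → (c + a) - (c + b) ≡ a - b
      cancel = solve-∀

    ∣⇒≈0 : ∀ {a} → p ℕ.∣ ∣ a ∣ → a ≈ 0ℤ [mod p ]
    ∣⇒≈0 {a} = mod-cong ∘ subst (λ x → p ℕ.∣ ∣ x ∣) (sym (ℤ.+-identityʳ a))

    ≈0⇒∣ : ∀ {a} → a ≈ 0ℤ [mod p ] → p ℕ.∣ ∣ a ∣
    ≈0⇒∣ {a} (mod-cong d) = subst (λ x → p ℕ.∣ ∣ x ∣) (ℤ.+-identityʳ a) d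

    ≈0? : ∀ a → Dec (a ≈ 0ℤ [mod p ])
    ≈0? a = map′ mod-cong ≡-mod (a ≡? 0ℤ [mod p ])

    ≈⇒-≈0 : ∀ {a b} → a ≈ b [mod p ] → a - b ≈ 0ℤ [mod p ]
    ≈⇒-≈0 = ∣⇒≈0 ∘ ≡-mod

    -≈0⇒≈ : ∀ {a b} → a - b ≈ 0ℤ [mod p ] → a ≈ b [mod p ]
    -≈0⇒≈ = mod-cong ∘ ≈0⇒∣

    *-zeroˡ-mod : ∀ {a} b → a ≈ 0ℤ [mod p ] → a * b ≈ 0ℤ [mod p ]
    *-zeroˡ-mod b a≈0 = ≈-mod-trans (*-cong-mod a≈0 ≈-mod-refl) (≈-mod-reflexive (ℤ.*-zeroˡ b))

    ^-≈0 : ∀ {a} n → a ≈ 0ℤ [mod p ] → 0 ℕ.< n → a ^ n ≈ 0ℤ [mod p ]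
    ^-≈0 (suc n) a≈0 _ = *-zeroˡ-mod _ a≈0

    euclidsLemma-mod : Prime p → ∀ a b → a * b ≈ 0ℤ [mod p ] → a ≈ 0ℤ [mod p ] ⊎ b ≈ 0ℤ [mod p ]
    euclidsLemma-mod p-prime a b ab≈0 = Sum.map ∣⇒≈0 ∣⇒≈0
      (euclidsLemma ∣ a ∣ ∣ b ∣ p-prime (subst (p ℕ.∣_) (ℤ.abs-* a b) (≈0⇒∣ ab≈0)))

  ≈-mod-setoid : ℕ → Setoid _ _
  ≈-mod-setoid p = record
    { Carrier       = ℤ
    ; _≈_           = λ a b → a ≈ b [mod p ]
    ; isEquivalence = record { refl = ≈-mod-refl ; sym = ≈-mod-sym ; trans = ≈-mod-trans }
    }

module BinomialCoefficients where

  open import Data.Nat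
  open import Data.Nat.Properties
  open import Data.Nat.Divisibility using (_∣_; divides; ∣⇒≤)
  open import Data.Nat.Combinatorics using (_C_; nC1≡n; k>n⇒nCk≡0; nCk+nC[k+1]≡[n+1]C[k+1])
  open import Data.Nat.Primality using (Prime; euclidsLemma)
  open import Data.Nat.Tactic.RingSolver using (solve-∀)
  open import Data.Sum using (inj₁; inj₂)
  open import Data.Empty using (⊥-elim)
  open import Relation.Binary.PropositionalEquality
    using (_≡_; refl; sym; trans; cong; cong₂; module ≡-Reasoning)

  [k+1]*[n+1]C[k+1]≡[n+1]*nCk : ∀ n k → suc k * (suc n C suc k) ≡ suc n * (n C k)
  [k+1]*[n+1]C[k+1]≡[n+1]*nCk zero    zero    = refl
  [k+1]*[n+1]C[k+1]≡[n+1]*nCk zero    (suc k)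
    rewrite k>n⇒nCk≡0 {1} {suc (suc k)} (s≤s (s≤s z≤n)) | k>n⇒nCk≡0 {0} {suc k} (s≤s z≤n)
    = *-zeroʳ (suc (suc k))
  [k+1]*[n+1]C[k+1]≡[n+1]*nCk (suc n) zero    =
    trans (+-identityʳ _) (trans (nC1≡n (suc (suc n))) (sym (*-identityʳ _)))
  [k+1]*[n+1]C[k+1]≡[n+1]*nCk (suc n) (suc k) = begin
    suc (suc k) * (suc (suc n) C suc (suc k))  ≡⟨ cong (suc (suc k) *_) (pascal (suc n) (suc k)) ⟨
    suc (suc k) * (X + Y)                      ≡⟨ expand k X Y ⟩
    (suc k * X + X) + suc (suc k) * Y          ≡⟨ cong₂ (λ a b → (a + X) + b)
                                                    ([k+1]*[n+1]C[k+1]≡[n+1]*nCk n k)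
                                                    ([k+1]*[n+1]C[k+1]≡[n+1]*nCk n (suc k)) ⟩
    (suc n * u + X) + suc n * v                ≡⟨ cong (λ a → (suc n * u + a) + suc n * v) (pascal n k) ⟨
    (suc n * u + (u + v)) + suc n * v          ≡⟨ collect n u v ⟩
    suc (suc n) * (u + v)                      ≡⟨ cong (suc (suc n) *_) (pascal n k) ⟩
    suc (suc n) * (suc n C suc k)              ∎
    where
    open ≡-Reasoning
    pascal : ∀ n k → n C k + n C suc k ≡ suc n C suc k
    pascal = nCk+nC[k+1]≡[n+1]C[k+1]
    X Y u v : ℕ
    X = suc n C suc k
    Y = suc n C suc (suc k)
    u = n C k
    v = n C suc k
    expand : ∀ k X Y → suc (suc k) * (X + Y) ≡ (suc k * X + X) + suc (suc k) * Y
    expand = solve-∀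
    collect : ∀ n u v → (suc n * u + (u + v)) + suc n * v ≡ suc (suc n) * (u + v)
    collect = solve-∀

  p∣pCk : ∀ {p k} → Prime p → 0 < k → k < p → p ∣ p C k
  p∣pCk {suc q} {suc j} p-prime _ k<p with euclidsLemma (suc j) (suc q C suc j) p-prime
    (divides (q C j) (trans ([k+1]*[n+1]C[k+1]≡[n+1]*nCk q j) (*-comm (suc q) (q C j))))
  ... | inj₁ p∣k   = ⊥-elim (<⇒≱ k<p (∣⇒≤ p∣k))
  ... | inj₂ p∣pCk = p∣pCk

module FermatsLittleTheorem where

  open CongruenceModP
  open BinomialCoefficients using (p∣pCk)
  open import Data.Nat as ℕ using (ℕ; zero; suc; _∸_; s≤s; z≤n)
  import Data.Nat.Properties as ℕ
  import Data.Nat.Divisibility as ℕ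
  open import Data.Nat.Combinatorics using (_C_; nCn≡1)
  open import Data.Nat.Primality using (Prime)
  open import Data.Fin using (Fin; zero; suc; toℕ; fromℕ; inject₁)
  open import Data.Fin.Properties using (toℕ-fromℕ; toℕ-inject₁; toℕ<n)
  open import Data.Integer as ℤ using (ℤ; +_; -[1+_]; 0ℤ; 1ℤ; _+_; _-_; _*_; _^_)
  import Data.Integer.Properties as ℤ
  open import Data.Integer.Tactic.RingSolver using (solve-∀)
  open import Data.Vec.Functional using (Vector; init)
  open import Data.Sum using (inj₁; inj₂)
  open import Data.Empty using (⊥-elim)
  open import Function using (_∘_)
  open import Relation.Nullary using (¬_)
  open import Relation.Binary.PropositionalEquality
    using (_≡_; refl; sym; trans; cong; cong₂; subst; module ≡-Reasoning)
  import Relation.Binary.Reasoning.Setoid as ≈-Reasoning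
  open import Algebra.Properties.CommutativeSemiring.Binomial ℤ.+-*-commutativeSemiring
    using (binomialTerm; theorem)
  open import Algebra.Properties.Monoid.Sum ℤ.+-0-monoid using (sum; sum-init-last)
  import Algebra.Properties.Semiring.Exp ℤ.+-*-semiring as Exp
  open import Algebra.Definitions.RawMonoid ℤ.+-0-rawMonoid using (_×_)

  ×≡* : ∀ n x → n × x ≡ + n * x
  ×≡* zero    x = sym (ℤ.*-zeroˡ x)
  ×≡* (suc n) x = begin
    x + n × x         ≡⟨ cong (λ y → x + y) (×≡* n x) ⟩
    x + + n * x       ≡⟨ cong (_+ + n * x) (ℤ.*-identityˡ x) ⟨
    1ℤ * x + + n * x  ≡⟨ ℤ.*-distribʳ-+ x 1ℤ (+ n) ⟨
    + suc n * x       ∎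
    where open ≡-Reasoning

  Exp^≡^ : ∀ x n → x Exp.^ n ≡ x ^ n
  Exp^≡^ x zero    = refl
  Exp^≡^ x (suc n) = cong (x *_) (Exp^≡^ x n)

  sum-≈0 : ∀ {p n} (t : Vector ℤ n) → (∀ i → t i ≈ 0ℤ [mod p ]) → sum t ≈ 0ℤ [mod p ]
  sum-≈0 {n = zero}  t t≈0 = ≈-mod-refl
  sum-≈0 {n = suc n} t t≈0 = +-cong-mod (t≈0 zero) (sum-≈0 (t ∘ suc) (t≈0 ∘ suc))

  ×-≈0 : ∀ {p m} y → p ℕ.∣ m → m × y ≈ 0ℤ [mod p ]
  ×-≈0 {m = m} y p∣m =
    subst (λ z → z ≈ 0ℤ [mod _ ]) (sym (×≡* m y)) (*-zeroˡ-mod y (∣⇒≈0 {a = + m} p∣m))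

  private
    module BinomialTerms (x : ℤ) (q : ℕ) where

      term : Fin (suc (suc q)) → ℤ
      term = binomialTerm 1ℤ x (suc q)

      term-at : ∀ i {k} → toℕ i ≡ k → term i ≡ (suc q C k) × (1ℤ Exp.^ k * x Exp.^ (suc q ∸ k))
      term-at i refl = refl

      first : term zero ≡ x ^ suc q
      first = begin
        1ℤ * x Exp.^ suc q + 0ℤ  ≡⟨ ℤ.+-identityʳ _ ⟩
        1ℤ * x Exp.^ suc q       ≡⟨ ℤ.*-identityˡ _ ⟩
        x Exp.^ suc q            ≡⟨ Exp^≡^ x (suc q) ⟩
        x ^ suc q                ∎
        where open ≡-Reasoning

      last : term (fromℕ (suc q)) ≡ 1ℤ
      last = begin
        term (fromℕ p)                            ≡⟨ term-at (fromℕ p) (toℕ-fromℕ p) ⟩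
        (p C p) × (1ℤ Exp.^ p * x Exp.^ (p ∸ p))  ≡⟨ cong₂ (λ m n → m × (1ℤ Exp.^ p * x Exp.^ n))
                                                           (nCn≡1 p) (ℕ.n∸n≡0 p) ⟩
        1ℤ Exp.^ p * 1ℤ + 0ℤ                      ≡⟨ cong (λ y → y * 1ℤ + 0ℤ)
                                                           (trans (Exp^≡^ 1ℤ p) (ℤ.^-zeroˡ p)) ⟩
        1ℤ                                        ∎
        where
        open ≡-Reasoning
        p : ℕ
        p = suc q

      middle : Prime (suc q) → sum (init (term ∘ suc)) ≈ 0ℤ [mod suc q ]
      middle p-prime = sum-≈0 (init (term ∘ suc)) λ i →
        subst (λ z → z ≈ 0ℤ [mod _ ]) (sym (term-at (suc (inject₁ i)) refl))
          (×-≈0 _ (p∣pCk p-prime (s≤s z≤n) (s≤s (subst (ℕ._< q) (sym (toℕ-inject₁ i)) (toℕ<n i)))))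

  -- Only the outer terms of the binomial expansion survive: p divides p C k for 0 < k < p.
  freshmansDream : ∀ {p} → Prime p → ∀ x → (1ℤ + x) ^ p ≈ 1ℤ + x ^ p [mod p ]
  freshmansDream {p@(suc q)} p-prime x = begin
    (1ℤ + x) ^ p                  ≡⟨ Exp^≡^ (1ℤ + x) p ⟨
    (1ℤ + x) Exp.^ p              ≡⟨ theorem p 1ℤ x ⟩
    term zero + sum (term ∘ suc)  ≡⟨ cong (λ s → term zero + s) (sum-init-last (term ∘ suc)) ⟩
    term zero + (sum (init (term ∘ suc)) + term (fromℕ p))
      ≈⟨ +-cong-mod (≈-mod-reflexive first) (+-cong-mod (middle p-prime) (≈-mod-reflexive last)) ⟩
    x ^ p + (0ℤ + 1ℤ)             ≡⟨ ℤ.+-comm (x ^ p) 1ℤ ⟩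
    1ℤ + x ^ p                    ∎
    where
    open ≈-Reasoning (≈-mod-setoid p)
    open BinomialTerms x q

  0^p≡0 : ∀ {p} → Prime p → 0ℤ ^ p ≡ 0ℤ
  0^p≡0 {suc q} _ = refl

  -- Induction over ℤ in both directions, each step being the freshman's dream.
  module _ {p : ℕ} (p-prime : Prime p) where

    private
      upward : ∀ x → x ^ p ≈ x [mod p ] → (1ℤ + x) ^ p ≈ 1ℤ + x [mod p ]
      upward x x^p≈x = ≈-mod-trans (freshmansDream p-prime x) (+-cong-mod (≈-mod-refl {a = 1ℤ}) x^p≈x)

      downward : ∀ x → (1ℤ + x) ^ p ≈ 1ℤ + x [mod p ] → x ^ p ≈ x [mod p ]
      downward x hyp = +-cancelˡ-mod 1ℤ (≈-mod-trans (≈-mod-sym (freshmansDream p-prime x)) hyp)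

    fermatsLittleTheorem : ∀ x → x ^ p ≈ x [mod p ]
    fermatsLittleTheorem (+ zero)     = ≈-mod-reflexive (0^p≡0 p-prime)
    fermatsLittleTheorem (+ suc n)    = upward (+ n) (fermatsLittleTheorem (+ n))
    fermatsLittleTheorem -[1+ zero ]  = downward -[1+ zero ] (fermatsLittleTheorem (+ zero))
    fermatsLittleTheorem -[1+ suc n ] = downward -[1+ suc n ] (fermatsLittleTheorem -[1+ n ])

  ^[p-1]≈1 : ∀ {p x} → Prime p → ¬ x ≈ 0ℤ [mod p ] → x ^ (p ∸ 1) ≈ 1ℤ [mod p ]
  ^[p-1]≈1 {suc q} {x} p-prime x≉0 with euclidsLemma-mod p-prime x (x ^ q - 1ℤ)
    (subst (λ z → z ≈ 0ℤ [mod suc q ]) (factor x (x ^ q)) (≈⇒-≈0 (fermatsLittleTheorem p-prime x)))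
    where
    factor : ∀ x y → x * y - x ≡ x * (y - 1ℤ)
    factor = solve-∀
  ... | inj₁ x≈0     = ⊥-elim (x≉0 x≈0)
  ... | inj₂ x^q-1≈0 = -≈0⇒≈ x^q-1≈0

  ^[p-1]^ℓ≈1 : ∀ {p ℓ x} → Prime p → 1 ℕ.≤ ℓ → ¬ x ≈ 0ℤ [mod p ] →
               x ^ ((p ∸ 1) ℕ.^ ℓ) ≈ 1ℤ [mod p ]
  ^[p-1]^ℓ≈1 {p} {suc l} {x} p-prime _ x≉0 = begin
    x ^ ((p ∸ 1) ℕ.* (p ∸ 1) ℕ.^ l)  ≡⟨ ℤ.^-*-assoc x (p ∸ 1) _ ⟨
    (x ^ (p ∸ 1)) ^ ((p ∸ 1) ℕ.^ l)  ≈⟨ ^-cong-mod ((p ∸ 1) ℕ.^ l) (^[p-1]≈1 p-prime x≉0) ⟩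
    1ℤ ^ ((p ∸ 1) ℕ.^ l)             ≡⟨ ℤ.^-zeroˡ ((p ∸ 1) ℕ.^ l) ⟩
    1ℤ                               ∎
    where open ≈-Reasoning (≈-mod-setoid p)

  ^[p-1]^ℓ≈0 : ∀ {p x} ℓ → Prime p → x ≈ 0ℤ [mod p ] → x ^ ((p ∸ 1) ℕ.^ ℓ) ≈ 0ℤ [mod p ]
  ^[p-1]^ℓ≈0 {suc (suc r)} ℓ _ x≈0 = ^-≈0 _ x≈0 (ℕ.m^n>0 (suc r) ℓ)

module PeriodTwoPoints where

  open CongruenceModP
  open FermatsLittleTheorem using (^[p-1]^ℓ≈0; ^[p-1]^ℓ≈1)
  open import Data.Nat as ℕ using (ℕ; suc)
  import Data.Nat.Divisibility as ℕ
  open import Data.Nat.Primality using (Prime)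
  open import Data.Integer as ℤ using (ℤ; +_; 0ℤ; 1ℤ; _+_)
  import Data.Integer.Properties as ℤ
  open import Data.List using (length; upTo)
  open import Data.List.Properties using (filter-none)
  import Data.List.Relation.Unary.All as All
  open import Data.Product using (_,_)
  open import Data.Empty using (⊥-elim)
  open import Function using (_∘_)
  open import Relation.Nullary using (¬_; yes; no)
  open import Relation.Binary.PropositionalEquality using (_≡_; _≢_; sym; trans; cong)

  φ≈c : ∀ {p y} ℓ c → Prime p → y ≈ 0ℤ [mod p ] → φ p ℓ c y ≈ c [mod p ]
  φ≈c ℓ c p-prime y≈0 = ≈-mod-trans (+-cong-mod (^[p-1]^ℓ≈0 ℓ p-prime y≈0) (≈-mod-refl {a = c}))
                                    (≈-mod-reflexive (ℤ.+-identityˡ c))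

  φ≈1+c : ∀ {p ℓ y} c → Prime p → 1 ℕ.≤ ℓ → ¬ y ≈ 0ℤ [mod p ] →
          φ p ℓ c y ≈ 1ℤ + c [mod p ]
  φ≈1+c c p-prime 1≤ℓ y≉0 = +-cong-mod (^[p-1]^ℓ≈1 p-prime 1≤ℓ y≉0) (≈-mod-refl {a = c})

  module _ {p ℓ : ℕ} (p-prime : Prime p) (1≤ℓ : 1 ℕ.≤ ℓ)
           {c : ℤ} (1+c≉0 : ¬ 1ℤ + c ≈ 0ℤ [mod p ]) where

    private
      f : ℤ → ℤ
      f = φ p ℓ c

    nonFixedValue≈c : ∀ x {y} → y ≈ f x [mod p ] → ¬ f y ≈ y [mod p ] → y ≈ c [mod p ]
    nonFixedValue≈c x {y} y≈fx fy≉y with ≈0? x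
    ... | yes x≈0 = ≈-mod-trans y≈fx (φ≈c ℓ c p-prime x≈0)
    ... | no  x≉0 = ⊥-elim (fy≉y (≈-mod-trans (φ≈1+c c p-prime 1≤ℓ y≉0) (≈-mod-sym y≈1+c)))
      where
      y≈1+c : y ≈ 1ℤ + c [mod p ]
      y≈1+c = ≈-mod-trans y≈fx (φ≈1+c c p-prime 1≤ℓ x≉0)
      y≉0 : ¬ y ≈ 0ℤ [mod p ]
      y≉0 y≈0 = 1+c≉0 (≈-mod-trans (≈-mod-sym y≈1+c) y≈0)

    noPeriod2Point : ∀ z → ¬ f z ≈ z [mod p ] → ¬ f (f z) ≈ z [mod p ]
    noPeriod2Point z fz≉z ffz≈z = fz≉z (≈-mod-trans fz≈c (≈-mod-sym z≈c))
      where
      z≈c : z ≈ c [mod p ]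
      z≈c = nonFixedValue≈c (f z) (≈-mod-sym ffz≈z) fz≉z
      fz≈c : f z ≈ c [mod p ]
      fz≈c = nonFixedValue≈c z ≈-mod-refl λ ffz≈fz →
        fz≉z (≈-mod-sym (≈-mod-trans (≈-mod-sym ffz≈z) ffz≈fz))

  Y2≡0 : ∀ {p ℓ c} → Prime p → 1 ℕ.≤ ℓ → ¬ 1ℤ + c ≈ 0ℤ [mod p ] → Y2 ℓ c p ≡ 0
  Y2≡0 {p} {ℓ} {c} p-prime 1≤ℓ 1+c≉0 = cong length (filter-none (period2? p ℓ c) {xs = upTo p}
    (All.tabulate λ {z} _ (fz≉z , ffz≈z) →
      noPeriod2Point p-prime 1≤ℓ 1+c≉0 (+ z) (fz≉z ∘ ≡-mod) (mod-cong ffz≈z)))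

  Y2≡2⇒p∣1+c : ∀ {p ℓ c} → Prime p → 1 ℕ.≤ ℓ → Y2 ℓ (+ c) p ≡ 2 → p ℕ.∣ suc c
  Y2≡2⇒p∣1+c {p} {ℓ} {c} p-prime 1≤ℓ Y2≡2 with p ℕ.∣? suc c
  ... | yes p∣1+c = p∣1+c
  ... | no  p∤1+c =
    ⊥-elim (0≢2 (trans (sym (Y2≡0 {p} {ℓ} {+ c} p-prime 1≤ℓ (p∤1+c ∘ ≈0⇒∣))) Y2≡2))
    where
    0≢2 : 0 ≢ 2
    0≢2 ()

module ListLengths where

  open import Data.Nat using (suc; _+_; _*_; _≤_; z≤n; s≤s)
  open import Data.Nat.Properties using (+-suc)
  open import Data.List using (List; []; _∷_; _++_; length; map; filter; cartesianProductWith)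
  import Data.List.Properties as List
  open import Data.List.Membership.Propositional using (_∈_)
  open import Data.List.Membership.Propositional.Properties using (∈-∃++)
  open import Data.List.Relation.Unary.Any using (here; there)
  import Data.List.Relation.Unary.All as All
  open import Data.List.Relation.Unary.AllPairs using (_∷_)
  open import Data.List.Relation.Unary.Unique.Propositional using (Unique)
  open import Data.Product using (_,_)
  open import Data.Empty using (⊥-elim)
  open import Function using (_∘_)
  open import Level using (0ℓ)
  open import Relation.Nullary using (yes; no; ¬?)
  open import Relation.Unary using (Pred; Decidable)
  open import Relation.Binary.PropositionalEquality
    using (_≡_; _≢_; refl; sym; trans; cong; cong₂; subst; module ≡-Reasoning)

  module _ {A : Set} where

    private
      ∈-remove : ∀ {y x : A} us {vs} → y ≢ x → y ∈ us ++ x ∷ vs → y ∈ us ++ vs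
      ∈-remove []       y≢x (here y≡x) = ⊥-elim (y≢x y≡x)
      ∈-remove []       y≢x (there y∈) = y∈
      ∈-remove (u ∷ us) y≢x (here y≡u) = here y≡u
      ∈-remove (u ∷ us) y≢x (there y∈) = there (∈-remove us y≢x y∈)

    Unique-⊆⇒length≤ : ∀ {xs ys : List A} → Unique xs → (∀ {x} → x ∈ xs → x ∈ ys) →
                       length xs ≤ length ys
    Unique-⊆⇒length≤ {[]}     _              _   = z≤n
    Unique-⊆⇒length≤ {x ∷ xs} (x∉xs ∷ uniq) xs⊆ys
      with us , vs , refl ← ∈-∃++ (xs⊆ys (here refl)) =
      subst (suc (length xs) ≤_) (sym (List.length-++-sucʳ us x vs))
        (s≤s (Unique-⊆⇒length≤ uniq λ y∈xs →
          ∈-remove us (λ y≡x → All.lookup x∉xs y∈xs (sym y≡x)) (xs⊆ys (there y∈xs))))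

    length-filter+filter-¬ : ∀ {P : Pred A 0ℓ} (P? : Decidable P) xs →
                             length (filter P? xs) + length (filter (¬? ∘ P?) xs) ≡ length xs
    length-filter+filter-¬ P? [] = refl
    length-filter+filter-¬ P? (x ∷ xs) with P? x
    ... | yes _ = cong suc (length-filter+filter-¬ P? xs)
    ... | no  _ = trans (+-suc _ _) (cong suc (length-filter+filter-¬ P? xs))

  length-cartesianProductWith : ∀ {A B C : Set} (f : A → B → C) xs ys →
                                length (cartesianProductWith f xs ys) ≡ length xs * length ys
  length-cartesianProductWith f []       ys = refl
  length-cartesianProductWith f (x ∷ xs) ys = begin
    length (map (f x) ys ++ cartesianProductWith f xs ys)          ≡⟨ List.length-++ (map (f x) ys) ⟩
    length (map (f x) ys) + length (cartesianProductWith f xs ys)  ≡⟨ cong₂ _+_ (List.length-map (f x) ys)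
                                                                               (length-cartesianProductWith f xs ys) ⟩
    length ys + length xs * length ys                              ∎
    where open ≡-Reasoning

module PrimeCounting where

  open ListLengths using (Unique-⊆⇒length≤; length-filter+filter-¬; length-cartesianProductWith)
  open import Data.Nat
  open import Data.Nat.Properties
  open import Data.Nat.Divisibility using (_∣_; divides; ∣⇒≤; 1∣_)
  open import Data.Nat.Primality using (Prime; euclidsLemma)
  open import Data.Nat.Primality.Factorisation
    using (PrimeFactorisation; factorise; factors; factorisationHasAllPrimeFactors)
  open import Data.Nat.ListAction using (product)
  open import Data.Nat.ListAction.Properties using (∈⇒∣product)
  open import Data.Nat.Tactic.RingSolver using (solve-∀)
  open import Data.List using (List; []; _∷_; _++_; [_]; length; map; filter; upTo; cartesianProductWith)
  import Data.List.Properties as List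
  open import Data.List.Membership.Propositional using (_∈_)
  open import Data.List.Membership.Propositional.Properties
    using (∈-++⁺ˡ; ∈-++⁺ʳ; ∈-++⁻; ∈-map⁺; ∈-map⁻; ∈-filter⁻; ∈-upTo⁺; ∈-upTo⁻;
           ∈-cartesianProductWith⁺)
  open import Data.List.Relation.Unary.Any using (here; there)
  open import Data.List.Relation.Unary.All as All using (All; []; _∷_)
  open import Data.List.Relation.Unary.AllPairs using (_∷_)
  open import Data.List.Relation.Unary.Unique.Propositional using (Unique)
  import Data.List.Relation.Unary.Unique.Propositional.Properties as Unique
  open import Data.Sum as Sum using (_⊎_; inj₁; inj₂)
  open import Data.Product using (_×_; _,_; ∃-syntax; ∃₂; proj₁; proj₂)
  open import Data.Empty using (⊥-elim)
  open import Function using (_∘_)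
  open import Relation.Nullary using (yes; no; ¬?)
  open import Relation.Binary.PropositionalEquality
    using (_≡_; refl; sym; trans; cong; cong₂; subst; module ≡-Reasoning)

  product-∣ : ∀ {n} xs → Unique xs → All (λ q → Prime q × q ∣ n) xs → product xs ∣ n
  product-∣ []       _              _                       = 1∣ _
  product-∣ (x ∷ xs) (x∉xs ∷ uniq) ((x-prime , x∣n) ∷ rest) with product-∣ xs uniq rest
  ... | divides k n≡k*P with euclidsLemma k (product xs) x-prime (subst (x ∣_) n≡k*P x∣n)
  ...   | inj₂ x∣P =
    ⊥-elim (All.lookup x∉xs (factorisationHasAllPrimeFactors x-prime x∣P (All.map proj₁ rest)) refl)
  ...   | inj₁ (divides k′ k≡k′*x) = divides k′ (begin
    _                       ≡⟨ n≡k*P ⟩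
    k * product xs          ≡⟨ cong (_* product xs) k≡k′*x ⟩
    k′ * x * product xs     ≡⟨ *-assoc k′ x (product xs) ⟩
    k′ * (x * product xs)   ∎)
    where open ≡-Reasoning

  m^length≤product : ∀ {m} xs → All (m ≤_) xs → m ^ length xs ≤ product xs
  m^length≤product []       []          = ≤-refl
  m^length≤product (x ∷ xs) (m≤x ∷ m≤xs) = *-mono-≤ m≤x (m^length≤product xs m≤xs)

  distinctPrimeDivisors-length≤ : ∀ {n} .{{_ : NonZero n}} m xs →
                                  Unique xs → All (λ q → Prime q × q ∣ n) xs →
                                  ∃[ j ] (length xs ≤ m + j × m ^ j ≤ n)
  distinctPrimeDivisors-length≤ {n} m xs uniq divs =
    length large , length-xs≤ ,
    ≤-trans (m^length≤product large m≤large) (∣⇒≤ (product-∣ large (Unique.filter⁺ _ uniq) divs-large))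
    where
    small large : List ℕ
    small = filter (_<? m) xs
    large = filter (¬? ∘ (_<? m)) xs
    length-small≤m : length small ≤ m
    length-small≤m = subst (length small ≤_) (List.length-upTo m)
      (Unique-⊆⇒length≤ (Unique.filter⁺ _ uniq) λ x∈small →
        ∈-upTo⁺ (proj₂ (∈-filter⁻ (_<? m) {xs = xs} x∈small)))
    length-xs≤ : length xs ≤ m + length large
    length-xs≤ = subst (_≤ m + length large) (length-filter+filter-¬ (_<? m) xs)
      (+-monoˡ-≤ (length large) length-small≤m)
    m≤large : All (m ≤_) large
    m≤large = All.tabulate λ x∈large → ≮⇒≥ (proj₂ (∈-filter⁻ (¬? ∘ (_<? m)) {xs = xs} x∈large))
    divs-large : All (λ q → Prime q × q ∣ n) large
    divs-large = All.tabulate λ x∈large →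
      All.lookup divs (proj₁ (∈-filter⁻ (¬? ∘ (_<? m)) {xs = xs} x∈large))

  subproducts : List ℕ → List ℕ
  subproducts []       = [ 1 ]
  subproducts (q ∷ qs) = subproducts qs ++ map (q *_) (subproducts qs)

  length-subproducts : ∀ qs → length (subproducts qs) ≡ 2 ^ length qs
  length-subproducts []       = refl
  length-subproducts (q ∷ qs) = begin
    length (xs ++ map (q *_) xs)        ≡⟨ List.length-++ xs ⟩
    length xs + length (map (q *_) xs)  ≡⟨ cong (length xs +_) (List.length-map (q *_) xs) ⟩
    length xs + length xs               ≡⟨ cong (λ l → l + l) (length-subproducts qs) ⟩
    2 ^ length qs + 2 ^ length qs       ≡⟨ cong (2 ^ length qs +_) (+-identityʳ (2 ^ length qs)) ⟨
    2 * 2 ^ length qs                   ∎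
    where
    open ≡-Reasoning
    xs : List ℕ
    xs = subproducts qs

  1∈subproducts : ∀ qs → 1 ∈ subproducts qs
  1∈subproducts []       = here refl
  1∈subproducts (q ∷ qs) = ∈-++⁺ˡ (1∈subproducts qs)

  subproduct-toggle : ∀ {p s} qs → p ∈ qs → s ∈ subproducts qs →
                      ∃[ s′ ] (s′ ∈ subproducts qs × (s ≡ p * s′ ⊎ s′ ≡ p * s))
  subproduct-toggle {p} (q ∷ qs) p∈ s∈ with ∈-++⁻ (subproducts qs) s∈ | p∈
  ... | inj₁ s∈qs | here refl = _ , ∈-++⁺ʳ _ (∈-map⁺ (q *_) s∈qs) , inj₂ refl
  ... | inj₁ s∈qs | there p∈qs with s′ , s′∈qs , s~s′ ← subproduct-toggle qs p∈qs s∈qs =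
    s′ , ∈-++⁺ˡ s′∈qs , s~s′
  ... | inj₂ s∈q*qs | _ with ∈-map⁻ (q *_) s∈q*qs | p∈
  ...   | t , t∈qs , refl | here refl = t , ∈-++⁺ˡ t∈qs , inj₁ refl
  ...   | t , t∈qs , refl | there p∈qs with t′ , t′∈qs , t~t′ ← subproduct-toggle qs p∈qs t∈qs =
    q * t′ , ∈-++⁺ʳ _ (∈-map⁺ (q *_) t′∈qs) , Sum.map q*-swap q*-swap t~t′
    where
    q*-swap : ∀ {x y} → x ≡ p * y → q * x ≡ p * (q * y)
    q*-swap {x} {y} x≡py = trans (cong (q *_) x≡py) (swap q p y)
      where
      swap : ∀ a b c → a * (b * c) ≡ b * (a * c)
      swap = solve-∀

  -- Each prime of the product flips its own parity bit, so what remains is a square.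
  square*subproduct : ∀ {ps} qs → All (_∈ ps) qs →
                      ∃₂ λ a s → s ∈ subproducts ps × product qs ≡ a * a * s
  square*subproduct {ps} [] [] = 1 , 1 , 1∈subproducts ps , refl
  square*subproduct {ps} (q ∷ qs) (q∈ps ∷ qs⊆ps)
    with square*subproduct qs qs⊆ps
  ... | a , s , s∈ , eq with subproduct-toggle ps q∈ps s∈
  ... | s′ , s′∈ , inj₁ s≡qs′ = q * a , s′ , s′∈ , (begin
    q * product qs      ≡⟨ cong (q *_) (trans eq (cong (a * a *_) s≡qs′)) ⟩
    q * (a * a * (q * s′)) ≡⟨ regroup q a s′ ⟩
    q * a * (q * a) * s′ ∎)
    where
    open ≡-Reasoning
    regroup : ∀ q a s′ → q * (a * a * (q * s′)) ≡ q * a * (q * a) * s′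
    regroup = solve-∀
  ... | s′ , s′∈ , inj₂ s′≡qs = a , s′ , s′∈ , (begin
    q * product qs      ≡⟨ cong (q *_) eq ⟩
    q * (a * a * s)     ≡⟨ regroup q a s ⟩
    a * a * (q * s)     ≡⟨ cong (a * a *_) s′≡qs ⟨
    a * a * s′          ∎)
    where
    open ≡-Reasoning
    regroup : ∀ q a s → q * (a * a * s) ≡ a * a * (q * s)
    regroup = solve-∀

  n≡square*subproduct : ∀ {ps} n .{{_ : NonZero n}} → (∀ {q} → Prime q → q ≤ n → q ∈ ps) →
                         ∃₂ λ a s → s ∈ subproducts ps × n ≡ a * a * s
  n≡square*subproduct n ps-covers =
    let a , s , s∈ , ∏≡a²s = square*subproduct (factors fact) factors⊆ps
    in  a , s , s∈ , trans (isFactorisation fact) ∏≡a²s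
    where
    open PrimeFactorisation using (isFactorisation; factorsPrime)
    fact : PrimeFactorisation n
    fact = factorise n
    factors⊆ps : All (_∈ _) (factors fact)
    factors⊆ps = All.tabulate λ q∈ → ps-covers (All.lookup (factorsPrime fact) q∈)
      (∣⇒≤ (subst (_ ∣_) (sym (isFactorisation fact)) (∈⇒∣product q∈)))

  m*m<n*n⇒m<n : ∀ {m n} → m * m < n * n → m < n
  m*m<n*n⇒m<n {m} {n} m²<n² with m <? n
  ... | yes m<n = m<n
  ... | no  m≮n = ⊥-elim (<⇒≱ m²<n² (*-mono-≤ (≮⇒≥ m≮n) (≮⇒≥ m≮n)))

  -- Erdős: each 1 ≤ n ≤ y is a² s with a < A and s a product of distinct primes from ps.
  erdős : ∀ ps y A → y < A * A → (∀ {q} → Prime q → q ≤ y → q ∈ ps) → y ≤ A * 2 ^ length ps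
  erdős ps y A y<A² ps-covers = begin
    y                                 ≡⟨ trans (List.length-map suc (upTo y)) (List.length-upTo y) ⟨
    length (map suc (upTo y))
      ≤⟨ Unique-⊆⇒length≤ (Unique.map⁺ suc-injective (Unique.upTo⁺ y)) covered ⟩
    length (cartesianProductWith f (upTo A) (subproducts ps))
      ≡⟨ length-cartesianProductWith f (upTo A) (subproducts ps) ⟩
    length (upTo A) * length (subproducts ps) ≡⟨ cong₂ _*_ (List.length-upTo A) (length-subproducts ps) ⟩
    A * 2 ^ length ps                 ∎
    where
    open ≤-Reasoning
    f : ℕ → ℕ → ℕ
    f a s = a * a * s
    covered-suc : ∀ {i} → i < y → suc i ∈ cartesianProductWith f (upTo A) (subproducts ps)
    covered-suc {i} i<y
      with n≡square*subproduct (suc i) (λ q-prime q≤n → ps-covers q-prime (≤-trans q≤n i<y))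
    ... | a , zero    , _  , n≡0   = ⊥-elim (1+n≢0 (trans n≡0 (*-zeroʳ (a * a))))
    ... | a , s@(suc _) , s∈ , n≡a²s =
      subst (_∈ cartesianProductWith f (upTo A) (subproducts ps)) (sym n≡a²s)
        (∈-cartesianProductWith⁺ f (∈-upTo⁺ (m*m<n*n⇒m<n {a} {A} a²<A²)) s∈)
      where
      a²<A² : a * a < A * A
      a²<A² = ≤-<-trans (≤-trans (subst (a * a ≤_) (sym n≡a²s) (m≤m*n (a * a) s)) i<y) y<A²
    covered : ∀ {n} → n ∈ map suc (upTo y) → n ∈ cartesianProductWith f (upTo A) (subproducts ps)
    covered n∈ with i , i∈ , refl ← ∈-map⁻ suc n∈ = covered-suc (∈-upTo⁻ i∈)

  4^n≡2^n*2^n : ∀ n → 4 ^ n ≡ 2 ^ n * 2 ^ n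
  4^n≡2^n*2^n zero    = refl
  4^n≡2^n*2^n (suc n) = trans (cong (4 *_) (4^n≡2^n*2^n n)) (regroup (2 ^ n))
    where
    regroup : ∀ u → 4 * (u * u) ≡ 2 * u * (2 * u)
    regroup = solve-∀

  n*n<[n+1]*[n+1] : ∀ n → n * n < (n + 1) * (n + 1)
  n*n<[n+1]*[n+1] n = subst (suc (n * n) ≤_) (sym (expand n)) (m≤m+n _ _)
    where
    expand : ∀ n → (n + 1) * (n + 1) ≡ suc (n * n) + 2 * n
    expand = solve-∀

  [2u+1]u<[2u]² : ∀ u → 0 < u → (2 * u + 1) * u < 2 * u * (2 * u)
  [2u+1]u<[2u]² (suc v) _ = subst (suc ((2 * suc v + 1) * suc v) ≤_) (sym (expand v)) (m≤m+n _ _)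
    where
    expand : ∀ v → 2 * suc v * (2 * suc v) ≡ suc ((2 * suc v + 1) * suc v) + (2 * v * v + 3 * v)
    expand = solve-∀

  -- With y = 4^(r+1) = T² and A = T + 1, Erdős' bound would give y ≤ (T + 1) T / 2 < y.
  c<4^[1+#primes≤c] : ∀ c ps → (∀ {q} → Prime q → q ≤ c → q ∈ ps) → c < 4 ^ suc (length ps)
  c<4^[1+#primes≤c] c ps ps-covers with 4 ^ suc (length ps) ≤? c
  ... | no  y≰c = ≰⇒> y≰c
  ... | yes y≤c = ⊥-elim (<⇒≱ count<y (erdős ps y (T + 1) y<[T+1]² covers-y))
    where
    r u T y : ℕ
    r = length ps
    u = 2 ^ r
    T = 2 * u
    y = 4 ^ suc r
    y≡T² : y ≡ T * T
    y≡T² = 4^n≡2^n*2^n (suc r)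
    y<[T+1]² : y < (T + 1) * (T + 1)
    y<[T+1]² = subst (_< (T + 1) * (T + 1)) (sym y≡T²) (n*n<[n+1]*[n+1] T)
    count<y : (T + 1) * u < y
    count<y = subst ((T + 1) * u <_) (sym y≡T²) ([2u+1]u<[2u]² u (m^n>0 2 r))
    covers-y : ∀ {q} → Prime q → q ≤ y → q ∈ ps
    covers-y q-prime q≤y = ps-covers q-prime (≤-trans q≤y y≤c)

module DensityEstimate where

  open PeriodTwoPoints using (Y2≡2⇒p∣1+c)
  open PrimeCounting using (distinctPrimeDivisors-length≤; c<4^[1+#primes≤c])
  open import Data.Nat
  open import Data.Nat.Properties
  open import Data.Nat.Primality using (Prime; composite⇒¬prime; composite[4])
  open import Data.Nat.Tactic.RingSolver using (solve-∀)
  open import Data.List using (_∷_; filter; upTo)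
  open import Data.List.Membership.Propositional using (_∈_)
  open import Data.List.Membership.Propositional.Properties using (∈-filter⁺; ∈-filter⁻; ∈-upTo⁺)
  open import Data.List.Relation.Unary.Any using (here; there)
  import Data.List.Relation.Unary.All as All
  import Data.List.Relation.Unary.Unique.Propositional.Properties as Unique
  open import Data.Product using (_×_; _,_; ∃-syntax; proj₂)
  open import Data.Empty using (⊥-elim)
  open import Function using (case_of_)
  open import Relation.Nullary using (yes; no)
  open import Relation.Binary.PropositionalEquality using (_≡_; refl; subst)

  numer≤m+logₘ[1+c] : ∀ {ℓ} c → 1 ≤ ℓ → ∀ m → ∃[ j ] (numer ℓ c ≤ m + j × m ^ j ≤ suc c)
  numer≤m+logₘ[1+c] {ℓ} c 1≤ℓ m = distinctPrimeDivisors-length≤ m _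
    (Unique.filter⁺ (primeInY2? ℓ c) (Unique.upTo⁺ (suc c)))
    (All.tabulate λ p∈ → case proj₂ (∈-filter⁻ (primeInY2? ℓ c) {xs = upTo (suc c)} p∈) of λ where
      ((p-prime , _) , Y2≡2) → p-prime , Y2≡2⇒p∣1+c p-prime 1≤ℓ Y2≡2)

  -- The denominator omits the primes 2 and 3.
  1+c≤4^[3+denom] : ∀ c → suc c ≤ 4 ^ (3 + denom c)
  1+c≤4^[3+denom] c = c<4^[1+#primes≤c] c (2 ∷ 3 ∷ filter (primeIn? c) (upTo (suc c))) covers
    where
    covers : ∀ {q} → Prime q → q ≤ c → q ∈ 2 ∷ 3 ∷ filter (primeIn? c) (upTo (suc c))
    covers {2} _ _ = here refl
    covers {3} _ _ = there (here refl)
    covers {4} 4-prime _ = ⊥-elim (composite⇒¬prime composite[4] 4-prime)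
    covers {suc (suc (suc (suc (suc _))))} q-prime q≤c = there (there
      (∈-filter⁺ (primeIn? c) (∈-upTo⁺ (s≤s q≤c)) (q-prime , 5≤q , q≤c)))
      where
      5≤q : 5 ≤ _
      5≤q = s≤s (s≤s (s≤s (s≤s (s≤s z≤n))))

  4^m≤4^n⇒m≤n : ∀ {m n} → 4 ^ m ≤ 4 ^ n → m ≤ n
  4^m≤4^n⇒m≤n {m} {n} 4^m≤4^n with m ≤? n
  ... | yes m≤n = m≤n
  ... | no  m≰n = ⊥-elim (<⇒≱ (^-monoʳ-< 4 (s≤s (s≤s z≤n)) (≰⇒> m≰n)) 4^m≤4^n)

  d≤K[m+Km+3] : ∀ {K m j d} → d ≤ K * (m + j) → suc K * j ≤ 3 + d → d ≤ K * (m + (K * m + 3))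
  d≤K[m+Km+3] {K} {m} {j} {d} d≤K[m+j] [1+K]j≤3+d =
    ≤-trans d≤K[m+j] (*-monoʳ-≤ K (+-monoʳ-≤ m j≤Km+3))
    where
    regroup : ∀ K m j → 3 + K * (m + j) ≡ (K * m + 3) + K * j
    regroup = solve-∀
    j≤Km+3 : j ≤ K * m + 3
    j≤Km+3 = +-cancelʳ-≤ (K * j) j (K * m + 3)
      (≤-trans [1+K]j≤3+d (subst (3 + d ≤_) (regroup K m j) (+-monoʳ-≤ 3 d≤K[m+j])))

  K*numer<denom : ∀ ℓ → 1 ≤ ℓ → ∀ K → ∃[ N ] (∀ c → N ≤ c → K * numer ℓ c < denom c)
  K*numer<denom ℓ 1≤ℓ K = 4 ^ (3 + D) , bound
    where
    m D : ℕ
    m = 4 ^ suc K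
    D = K * (m + (K * m + 3))
    bound : ∀ c → 4 ^ (3 + D) ≤ c → K * numer ℓ c < denom c
    bound c N≤c with K * numer ℓ c <? denom c | numer≤m+logₘ[1+c] c 1≤ℓ m
    ... | yes K*numer<d | _ = K*numer<d
    ... | no  K*numer≮d | j , numer≤m+j , m^j≤1+c =
      ⊥-elim (<⇒≱ (≤-trans (1+c≤4^[3+denom] c) (^-monoʳ-≤ 4 (+-monoʳ-≤ 3 d≤D))) N≤c)
      where
      d : ℕ
      d = denom c
      [1+K]j≤3+d : suc K * j ≤ 3 + d
      [1+K]j≤3+d = 4^m≤4^n⇒m≤n (subst (_≤ 4 ^ (3 + d)) (^-*-assoc 4 (suc K) j)
        (≤-trans m^j≤1+c (1+c≤4^[3+denom] c)))
      d≤D : d ≤ D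
      d≤D = d≤K[m+Km+3] {K} {m} {j} {d}
        (≤-trans (≮⇒≥ K*numer≮d) (*-monoʳ-≤ K numer≤m+j)) [1+K]j≤3+d

open import Data.Nat as ℕ using (ℕ; suc; _≤_)
import Data.Nat.Properties as ℕ
open import Data.Nat.Coprimality using (1-coprimeTo) renaming (sym to coprime-sym)
open import Data.Integer as ℤ using (+_; +[1+_]; -[1+_])
import Data.Integer.Properties as ℤ
open import Data.Rational using (ℚ; mkℚ; _/_; _<_; _*_; 0ℚ; toℚᵘ; positive)
open import Data.Rational.Properties using (toℚᵘ-cancel-<; toℚᵘ-homo-*; normalize-coprime)
import Data.Rational.Unnormalised as ℚᵘ
import Data.Rational.Unnormalised.Properties as ℚᵘ
open import Data.Product using (∃-syntax; _,_)
open import Relation.Binary.PropositionalEquality using (_≡_; sym; trans; cong; subst₂)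

n/1≡mkℚ : ∀ n → (+ n) / 1 ≡ mkℚ (+ n) 0 (coprime-sym (1-coprimeTo n))
n/1≡mkℚ n = normalize-coprime (coprime-sym (1-coprimeTo n))

-- For ε = (n + 1)/(e + 1) take K = e + 1, so that a < b/(e + 1) ≤ ε b; the inequality is
-- checked on cross-multiplied numerators of the unnormalised rationals.
K*a<b⇒a<ε*b : (ε : ℚ) → 0ℚ < ε →
              ∃[ K ] (∀ a b → K ℕ.* a ℕ.< b → (+ a) / 1 < ε * ((+ b) / 1))
K*a<b⇒a<ε*b ε@(mkℚ +[1+ n ] e _) _ = suc e , λ a b K*a<b →
  toℚᵘ-cancel-< (ℚᵘ.<-respʳ-≃ (ℚᵘ.≃-sym (toℚᵘ-homo-* ε ((+ b) / 1)))
    (subst₂ (λ x y → toℚᵘ x ℚᵘ.< toℚᵘ ε ℚᵘ.* toℚᵘ y) (sym (n/1≡mkℚ a)) (sym (n/1≡mkℚ b))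
      (ℚᵘ.*<* (subst₂ ℤ._<_ (ℤ.pos-* a (suc (e ℕ.* 1)))
                            (trans (ℤ.pos-* (suc n ℕ.* b) 1) (cong (ℤ._* + 1) (ℤ.pos-* (suc n) b)))
                (ℤ.+<+ (cross-multiplied a b K*a<b))))))
  where
  cross-multiplied : ∀ a b → suc e ℕ.* a ℕ.< b → a ℕ.* suc (e ℕ.* 1) ℕ.< suc n ℕ.* b ℕ.* 1
  cross-multiplied a b K*a<b =
    subst₂ ℕ._<_ (trans (ℕ.*-comm (suc e) a) (cong (λ t → a ℕ.* suc t) (sym (ℕ.*-identityʳ e))))
                 (sym (ℕ.*-identityʳ _))
                 (ℕ.<-≤-trans K*a<b (ℕ.m≤n*m b (suc n)))
K*a<b⇒a<ε*b (mkℚ (+ 0) _ _) 0<ε with positive 0<ε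
... | ()
K*a<b⇒a<ε*b (mkℚ -[1+ _ ] _ _) 0<ε with positive 0<ε
... | ()

corollary9p1 : (ℓ : ℕ) → 1 ≤ ℓ →
    (ε : ℚ) → 0ℚ < ε →
      ∃[ N ] ((c : ℕ) → N ≤ c →
        (+ numer ℓ c) / 1 < ε * ((+ denom c) / 1))
corollary9p1 ℓ 1≤ℓ ε 0<ε =
  let K , ratio<ε       = K*a<b⇒a<ε*b ε 0<ε
      N , K*numer<denom = DensityEstimate.K*numer<denom ℓ 1≤ℓ K
  in  N , λ c N≤c → ratio<ε (numer ℓ c) (denom c) (K*numer<denom c N≤c)
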